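{- Let $k\ge 1$ and let $G$ be a finite $S_k$-free graph with no isolated vertices. Let $A\subseteq V(G)$ be an independent set of vertices in $G$ and let $B=V(G)\setminus A$. Then there is a coloring of the vertices of $B$ using at most $k$ colors such that for every vertex $v\in A$, some color appears on exactly one vertex of $N_G(v)$.
   Context: $N_G(v)=\{u\in V(G): \{u,v\}\in E(G)\}$ is the open neighborhood of $v$. $S_k$ denotes the star $K_{1,k}$ on $k+1$ vertices; $G$ is $S_k$-free if it contains no induced subgraph isomorphic to $S_k$. -}

module Defs where

open import Data.Nat using (ℕ)
open import Data.Fin using (Fin)
open import Data.Bool using (Bool; true; false)
open import Data.Product using (Σ; ∃; _×_)
open import Relation.Binary.PropositionalEquality using (_≡_; _≢_)
open import Relation.Nullary using (¬_)
open import Function.Definitions using (Injective)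

record Graph (n : ℕ) : Set where
  field
    adj    : Fin n → Fin n → Bool
    sym    : ∀ u v → adj u v ≡ adj v u
    irrefl : ∀ v → adj v v ≡ false

open Graph public

Adj : ∀ {n} → Graph n → Fin n → Fin n → Set
Adj G u v = adj G u v ≡ true

Isolated : ∀ {n} → Graph n → Fin n → Set
Isolated G v = ∀ u → ¬ Adj G v u

-- G contains an induced copy of the star S_k = K_{1,k}: a centre c and k
-- distinct leaves, each adjacent to c, pairwise non-adjacent.
-- (Leaves differ from c automatically since the graph is loopless.)
HasInducedStar : ∀ {n} → ℕ → Graph n → Set
HasInducedStar {n} k G =
  Σ (Fin n) λ c → Σ (Fin k → Fin n) λ f →
    Injective _≡_ _≡_ f
    × (∀ i → Adj G c (f i))
    × (∀ i j → i ≢ j → ¬ Adj G (f i) (f j))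

StarFree : ∀ {n} → ℕ → Graph n → Set
StarFree k G = ¬ HasInducedStar k G

Independent : ∀ {n} → Graph n → (Fin n → Bool) → Set
Independent G A = ∀ u v → A u ≡ true → A v ≡ true → ¬ Adj G u v

-- Under the coloring col (only its values on B = V ∖ A matter), the color j
-- appears on exactly one vertex of N_G(v) ∩ B.
UniqueColorAt : ∀ {n k} → Graph n → (Fin n → Bool) → (Fin n → Fin k) →
                Fin n → Fin k → Set
UniqueColorAt {n} G A col v j =
  Σ (Fin n) λ u →
    (Adj G v u × A u ≡ false × col u ≡ j)
    × (∀ w → Adj G v w → A w ≡ false → col w ≡ j → w ≡ u)

module Submission where

-- Colour the vertices greedily in some order (vertices of A get colours too; they are never
-- inspected). For every v ∈ A that already has a coloured neighbour, keep a label J v: a colour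
-- occurring exactly once on the coloured neighbours of v outside A. The next vertex x takes a
-- colour different from the labels of all its neighbours in A. Such a colour exists: these
-- neighbours are pairwise non-adjacent, so if they carried all k labels, one neighbour per label
-- would form an induced S_k centred at x. A vertex of A meeting its first coloured neighbour x
-- (necessarily outside A) takes the colour of x as its label.

open import Defs
open import Data.Nat using (ℕ; _≥_; suc)
open import Data.Fin using (Fin; zero)
open import Data.Fin.Properties using (any?; all?; ¬∀⟶∃¬; _≟_)
open import Data.Bool using (Bool; true; false)
open import Data.Bool.Properties using () renaming (_≟_ to _≟ᵇ_)
open import Data.List using (List; []; _∷_; allFin)
open import Data.List.Membership.Propositional using (_∈_; lose)
open import Data.List.Membership.Propositional.Properties using (∈-allFin)
open import Data.List.Relation.Unary.All as All using (All; []; _∷_)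
open import Data.List.Relation.Unary.Any as Any using (Any; here; there)
open import Data.List.Relation.Unary.AllPairs using ([]; _∷_)
open import Data.List.Relation.Unary.Unique.Propositional using (Unique)
open import Data.List.Relation.Unary.Unique.Propositional.Properties using (allFin⁺)
open import Data.Product using (Σ; ∃; _×_; _,_; proj₁; proj₂)
open import Data.Empty using (⊥-elim)
open import Data.Vec.Functional using (updateAt)
open import Data.Vec.Functional.Properties using (updateAt-updates; updateAt-minimal)
open import Function using (const; _∘_)
open import Relation.Nullary using (¬_; Dec; yes; no)
open import Relation.Nullary.Decidable using (_×-dec_)
open import Relation.Binary.PropositionalEquality as ≡ using (_≡_; _≢_; refl; trans; cong)

module _ {n : ℕ} (G : Graph n) where

  nonIsolated⇒neighbour : ∀ {v} → ¬ Isolated G v → ∃ (Adj G v)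
  nonIsolated⇒neighbour {v} ¬iso with any? (λ u → adj G v u ≟ᵇ true)
  ... | yes nbr = nbr
  ... | no ¬nbr = ⊥-elim (¬iso λ u a → ¬nbr (u , a))

module _ {n : ℕ} (G : Graph n) (A : Fin n → Bool) where

  independent⇒outside : Independent G A → ∀ {v u} → A v ≡ true → Adj G v u → A u ≡ false
  independent⇒outside ind {v} {u} Av a with A u in Au
  ... | true  = ⊥-elim (ind v u Av Au a)
  ... | false = refl

  LabelledNeighbour : ∀ {k} → (Fin n → Fin k) → Fin n → Fin k → Fin n → Set
  LabelledNeighbour J x c v = A v ≡ true × Adj G x v × J v ≡ c

  allLabelsAround⇒inducedStar : ∀ {k} → Independent G A → (J : Fin n → Fin k) (x : Fin n) →
                                 (∀ c → ∃ (LabelledNeighbour J x c)) → HasInducedStar k G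
  allLabelsAround⇒inducedStar {k} ind J x nbr = x , leaf , leaf-injective , adjacent , leaves-independent
    where
    leaf : Fin k → Fin n
    leaf = proj₁ ∘ nbr
    inA : ∀ c → A (leaf c) ≡ true
    inA c = proj₁ (proj₂ (nbr c))
    adjacent : ∀ c → Adj G x (leaf c)
    adjacent c = proj₁ (proj₂ (proj₂ (nbr c)))
    label : ∀ c → J (leaf c) ≡ c
    label c = proj₂ (proj₂ (proj₂ (nbr c)))
    leaf-injective : ∀ {c d} → leaf c ≡ leaf d → c ≡ d
    leaf-injective {c} {d} eq = trans (≡.sym (label c)) (trans (cong J eq) (label d))
    leaves-independent : ∀ c d → c ≢ d → ¬ Adj G (leaf c) (leaf d)
    leaves-independent c d _ = ind (leaf c) (leaf d) (inA c) (inA d)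

  labelledNeighbour? : ∀ {k} (J : Fin n → Fin k) x c → Dec (∃ (LabelledNeighbour J x c))
  labelledNeighbour? J x c = any? λ v → (A v ≟ᵇ true) ×-dec ((adj G x v ≟ᵇ true) ×-dec (J v ≟ c))

  missingLabelAround : ∀ {k} → StarFree k G → Independent G A → (J : Fin n → Fin k) (x : Fin n) →
                       ∃ λ c → ∀ v → ¬ LabelledNeighbour J x c v
  missingLabelAround {k} sf ind J x with all? (labelledNeighbour? J x)
  ... | yes all = ⊥-elim (sf (allLabelsAround⇒inducedStar ind J x all))
  ... | no ¬all = let c , ¬labelled = ¬∀⟶∃¬ k _ (labelledNeighbour? J x) ¬all in c , λ v l → ¬labelled (v , l)

  ColouredNeighbour : ∀ {k} → (Fin n → Fin k) → Fin n → Fin k → Fin n → Set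
  ColouredNeighbour col v j u = Adj G v u × A u ≡ false × col u ≡ j

  UniqueColourIn : ∀ {k} → List (Fin n) → (Fin n → Fin k) → Fin n → Fin k → Set
  UniqueColourIn xs col v j =
    Σ (Fin n) λ u → (u ∈ xs × ColouredNeighbour col v j u) × All (λ w → ColouredNeighbour col v j w → w ≡ u) xs

  uniqueColourIn-recolour : ∀ {k xs} {col col′ : Fin n → Fin k} {v j} → All (λ w → col w ≡ col′ w) xs →
                            UniqueColourIn xs col v j → UniqueColourIn xs col′ v j
  uniqueColourIn-recolour agree (u , (u∈xs , a , Au , cu) , unique) =
    u , (u∈xs , a , Au , trans (≡.sym (All.lookup agree u∈xs)) cu) ,
    All.zipWith (λ { (onlyU , eq) (a , Aw , cw) → onlyU (a , Aw , trans eq cw) }) (unique , agree)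

  uniqueColourIn-∷ : ∀ {k xs x} {col : Fin n → Fin k} {v j} → ¬ ColouredNeighbour col v j x →
                     UniqueColourIn xs col v j → UniqueColourIn (x ∷ xs) col v j
  uniqueColourIn-∷ ¬cx (u , (u∈xs , cu) , unique) = u , (there u∈xs , cu) , (⊥-elim ∘ ¬cx) ∷ unique

  uniqueColourIn-first : ∀ {k xs x} {col : Fin n → Fin k} {v j} → ¬ Any (Adj G v) xs →
                         ColouredNeighbour col v j x → UniqueColourIn (x ∷ xs) col v j
  uniqueColourIn-first ¬nbr cx =
    _ , (here refl , cx) , (const refl) ∷ All.tabulate (λ w∈xs (a , _) → ⊥-elim (¬nbr (lose w∈xs a)))

  neighbourIn? : ∀ xs v → Dec (Any (Adj G v) xs)
  neighbourIn? xs v = Any.any? (λ u → adj G v u ≟ᵇ true) xs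

  Witnessed : ∀ {k} → List (Fin n) → (Fin n → Fin k) → (Fin n → Fin k) → Set
  Witnessed xs col J = ∀ v → A v ≡ true → Any (Adj G v) xs → UniqueColourIn xs col v (J v)

  relabel : ∀ {k} → List (Fin n) → Fin k → (Fin n → Fin k) → Fin n → Fin k
  relabel xs c J v with neighbourIn? xs v
  ... | yes _ = J v
  ... | no _  = c

  witnessed-∷ : ∀ {k xs x} {col J : Fin n → Fin k} {c} → Independent G A → All (x ≢_) xs →
                (∀ v → ¬ LabelledNeighbour J x c v) → Witnessed xs col J →
                Witnessed (x ∷ xs) (updateAt col x (const c)) (relabel xs c J)
  witnessed-∷ {xs = xs} {x} {col} {J} {c} ind x∉xs avoid wit v Av nbr with neighbourIn? xs v
  ... | yes old = uniqueColourIn-∷ ¬coloured (uniqueColourIn-recolour unchanged (wit v Av old))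
    where
    unchanged : All (λ w → col w ≡ updateAt col x (const c) w) xs
    unchanged = All.map (λ x≢w → ≡.sym (updateAt-minimal _ x col (x≢w ∘ ≡.sym))) x∉xs
    ¬coloured : ¬ ColouredNeighbour (updateAt col x (const c)) v (J v) x
    ¬coloured (a , _ , cx) = avoid v (Av , trans (Graph.sym G x v) a , trans (≡.sym cx) (updateAt-updates x col))
  ... | no ¬old = uniqueColourIn-first ¬old (a , independent⇒outside ind Av a , updateAt-updates x col)
    where a = Any.head ¬old nbr

  greedyColouring : ∀ {k} → StarFree k G → Independent G A → Fin k → (xs : List (Fin n)) → Unique xs →
                    Σ (Fin n → Fin k) λ col → Σ (Fin n → Fin k) (Witnessed xs col)
  greedyColouring sf ind c₀ []       []                 = const c₀ , const c₀ , λ _ _ ()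
  greedyColouring sf ind c₀ (x ∷ xs) (x∉xs ∷ xs-unique) =
    let col , J , wit = greedyColouring sf ind c₀ xs xs-unique
        c , avoid     = missingLabelAround sf ind J x
    in  updateAt col x (const c) , relabel xs c J , witnessed-∷ ind x∉xs avoid wit

  uniqueColourIn-allFin : ∀ {k} {col : Fin n → Fin k} {v j} →
                          UniqueColourIn (allFin n) col v j → UniqueColorAt G A col v j
  uniqueColourIn-allFin (u , (_ , cu) , unique) =
    u , cu , λ w a Aw cw → All.lookup unique (∈-allFin w) (a , Aw , cw)

lemma1 : (k : ℕ) → k ≥ 1 → (n : ℕ) → (G : Graph n) → StarFree k G →
         (∀ v → ¬ Isolated G v) →
         (A : Fin n → Bool) → Independent G A →
         Σ (Fin n → Fin k) λ col →
           ∀ v → A v ≡ true → ∃ λ j → UniqueColorAt G A col v j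
lemma1 (suc k) _ n G sf noIsolated A ind =
  let col , J , wit = greedyColouring G A sf ind zero (allFin n) (allFin⁺ n)
  in  col , λ v Av → J v , uniqueColourIn-allFin G A (wit v Av (neighbourInAllFin v))
  where
  neighbourInAllFin : ∀ v → Any (Adj G v) (allFin n)
  neighbourInAllFin v = let u , a = nonIsolated⇒neighbour G (noIsolated v) in lose (∈-allFin u) a
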